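{- Let $t_1\ge 2$ be odd and $t_2\ge 2$ be even. If $G\in\mathcal{A}(t_1,t_2)$, then $G\in\mathcal{P}(3)\cap\tilde{\mathcal{Q}}(3,2)$.
   Context: A connected dominating set of $G$ is a set $D$ such that every vertex is in $D$ or adjacent to a vertex of $D$ and $G[D]$ is connected; $\gamma_c(G)$ is its minimum size, and a minimum one is a $\gamma_c$-set. $G$ is $k$-$\gamma_c$-critical if $\gamma_c(G)=k$ and $\gamma_c(G+uv)<k$ for all non-adjacent $u,v$. $G$ is $\ell$-factor critical if $G-S$ has a perfect matching for every set $S$ of $\ell$ vertices. $\mathcal{P}(k)$: a $k$-$\gamma_c$-critical graph $G$ belongs to $\mathcal{P}(k)$ if it has a maximal complete subgraph $H$ with at least two vertices such that (i) for every vertex $x$ of $G$ there is a $\gamma_c$-set $D$ of $G$ with $x\in D$ and $D\cap V(H)\ne\emptyset$; (ii) for every pair of non-adjacent vertices $x,y$ there is a connected dominating set $D'_{xy}$ of $G+xy$ with $|D'_{xy}|<k$ and $D'_{xy}\cap V(H)\ne\emptyset$. $\tilde{\mathcal{Q}}(k,\ell)$: the class of $k$-$\gamma_c$-critical $K_{1,3}$-free graphs (no induced $K_{1,3}$) with minimum degree at least $\ell+1$ that are not $\ell$-factor critical. $\mathcal{A}(t_1,t_2)$: the graph obtained from vertices $x_1,x_2,x_3$ and disjoint complete graphs $K_{t_1},K_{t_2}$ by making $x_1$ and $x_2$ adjacent to every vertex of $K_{t_1}$, adding the edge $x_2x_3$, and making $x_1$ and $x_3$ adjacent to every vertex of $K_{t_2}$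 (no other edges). -}

module Defs where

open import Data.Nat using (ℕ; zero; suc; _+_; _<_; _≤_; _<ᵇ_)
open import Data.Bool using (Bool; true; false; T; if_then_else_; not; _∧_; _∨_)
open import Data.Fin using (Fin; toℕ; _≟_)
open import Data.Fin.Subset using (Subset; _∈_; _∉_; ∣_∣)
open import Data.Vec using (tabulate)
open import Data.Product using (Σ; ∃; _×_; _,_)
open import Data.Sum using (_⊎_)
open import Relation.Nullary using (¬_; ⌊_⌋)
open import Relation.Binary.PropositionalEquality using (_≡_; _≢_)

-- Finite simple graphs on vertex set Fin n, given by a Boolean
-- adjacency function (all graphs used below are symmetric and loopless).

Graph : ℕ → Set
Graph n = Fin n → Fin n → Bool

module _ {n : ℕ} where

  Edge : Graph n → Fin n → Fin n → Set
  Edge G u v = T (G u v)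

  NonAdj : Graph n → Fin n → Fin n → Set
  NonAdj G u v = u ≢ v × ¬ Edge G u v

  addEdge : Graph n → Fin n → Fin n → Graph n
  addEdge G u v x y =
    G x y ∨ (⌊ x ≟ u ⌋ ∧ ⌊ y ≟ v ⌋) ∨ (⌊ x ≟ v ⌋ ∧ ⌊ y ≟ u ⌋)

  data Reach (G : Graph n) (D : Subset n) : Fin n → Fin n → Set where
    here : ∀ {u} → u ∈ D → Reach G D u u
    step : ∀ {u w v} → u ∈ D → Edge G u w → Reach G D w v → Reach G D u v

  InducedConnected : Graph n → Subset n → Set
  InducedConnected G D = ∀ u v → u ∈ D → v ∈ D → Reach G D u v

  Dominating : Graph n → Subset n → Set
  Dominating G D = ∀ v → v ∈ D ⊎ Σ (Fin n) (λ u → u ∈ D × Edge G u v)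

  IsCDS : Graph n → Subset n → Set
  IsCDS G D = Dominating G D × InducedConnected G D

  GammaC : Graph n → ℕ → Set
  GammaC G k = Σ (Subset n) (λ D → IsCDS G D × ∣ D ∣ ≡ k)
             × (∀ D → IsCDS G D → k ≤ ∣ D ∣)

  IsGammaCSet : Graph n → Subset n → Set
  IsGammaCSet G D = IsCDS G D × (∀ D′ → IsCDS G D′ → ∣ D ∣ ≤ ∣ D′ ∣)

  Critical : ℕ → Graph n → Set
  Critical k G = GammaC G k
    × (∀ u v → NonAdj G u v → Σ ℕ (λ m → m < k × GammaC (addEdge G u v) m))

  Meets : Subset n → Subset n → Set
  Meets A B = Σ (Fin n) (λ v → v ∈ A × v ∈ B)

  IsClique : Graph n → Subset n → Set
  IsClique G H = ∀ u v → u ∈ H → v ∈ H → u ≢ v → Edge G u v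

  IsMaximalClique : Graph n → Subset n → Set
  IsMaximalClique G H = IsClique G H
    × (∀ x → x ∉ H → Σ (Fin n) (λ h → h ∈ H × ¬ Edge G x h))

  InP : ℕ → Graph n → Set
  InP k G = Critical k G × Σ (Subset n) (λ H →
      IsMaximalClique G H × 2 ≤ ∣ H ∣
    × (∀ x → Σ (Subset n) (λ D → IsGammaCSet G D × x ∈ D × Meets D H))
    × (∀ x y → NonAdj G x y → Σ (Subset n) (λ D →
         IsCDS (addEdge G x y) D × ∣ D ∣ < k × Meets D H)))

  ClawFree : Graph n → Set
  ClawFree G = ∀ c a b d →
      Edge G c a → Edge G c b → Edge G c d →
      a ≢ b → a ≢ d → b ≢ d →
      ¬ (¬ Edge G a b × ¬ Edge G a d × ¬ Edge G b d)

  degree : Graph n → Fin n → ℕ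
  degree G v = ∣ tabulate (G v) ∣

  MinDegreeAtLeast : ℕ → Graph n → Set
  MinDegreeAtLeast d G = ∀ v → d ≤ degree G v

  -- a perfect matching of G - S, as a fixed-point-free involution on
  -- V(G) ∖ S pairing each vertex with a neighbour outside S
  PerfectMatchingMinus : Graph n → Subset n → Set
  PerfectMatchingMinus G S = Σ (Fin n → Fin n) (λ m →
    ∀ v → v ∉ S → m v ∉ S × Edge G v (m v) × m (m v) ≡ v)

  FactorCritical : ℕ → Graph n → Set
  FactorCritical ℓ G = ∀ S → ∣ S ∣ ≡ ℓ → PerfectMatchingMinus G S

  InQ : ℕ → ℕ → Graph n → Set
  InQ k ℓ G = Critical k G × ClawFree G × MinDegreeAtLeast (suc ℓ) G
            × ¬ FactorCritical ℓ G

-- The graph 𝒜(t₁,t₂) on vertex set Fin (3 + t₁ + t₂):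
-- 0 = x₁, 1 = x₂, 2 = x₃, 3 .. 2+t₁ = K_{t₁}, the rest = K_{t₂}.

data Part : Set where
  X1 X2 X3 K1 K2 : Part

part : (t₁ t₂ : ℕ) → Fin (3 + t₁ + t₂) → Part
part t₁ t₂ v with toℕ v
... | 0 = X1
... | 1 = X2
... | 2 = X3
... | i = if i <ᵇ (3 + t₁) then K1 else K2

partEdge : Part → Part → Bool
partEdge X1 K1 = true
partEdge K1 X1 = true
partEdge X2 K1 = true
partEdge K1 X2 = true
partEdge X2 X3 = true
partEdge X3 X2 = true
partEdge X1 K2 = true
partEdge K2 X1 = true
partEdge X3 K2 = true
partEdge K2 X3 = true
partEdge K1 K1 = true
partEdge K2 K2 = true
partEdge _  _  = false

𝒜 : (t₁ t₂ : ℕ) → Graph (3 + t₁ + t₂)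
𝒜 t₁ t₂ u v = not ⌊ u ≟ v ⌋ ∧ partEdge (part t₁ t₂ u) (part t₁ t₂ v)

module Submission where

-- The parts x₁, K₁, x₂, x₃, K₂ of 𝒜(t₁,t₂) form a 5-cycle in which K₁ and
-- K₂ are cliques, so every adjacency question about vertices reduces to
-- one about parts. For
-- 𝒜(t₁,t₂) it then shows: every connected dominating set meets three
-- parts, so γc = 3 with witness k₁ - x₁ - k₂; every 𝒜 + uv has a
-- connected dominating pair meeting H = {x₁} ∪ K₁ while no single vertex
-- dominates it, so γc(𝒜 + uv) = 2; each neighbourhood is covered by two
-- cliques; every vertex has three neighbours; and removing {x₁, x₂} leaves
-- K₁, of odd size t₁, without neighbours outside it.

open import Data.Bool using (Bool; true; false; T; _∧_)
open import Data.Bool.Properties using (T-∧; T-∨; T-≡)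
open import Data.Empty using (⊥; ⊥-elim)
open import Data.Fin using (Fin; zero; suc; _≟_; toℕ; _↑ˡ_; _↑ʳ_; splitAt; join)
import Data.Fin.Properties as Fin
open import Data.Fin.Properties using (toℕ-↑ˡ; toℕ-↑ʳ; ↑ˡ-injective; ↑ʳ-injective; toℕ<n; join-splitAt)
open import Data.Fin.Subset using (Subset; _∈_; _∉_; ∣_∣; _∪_; ⁅_⁆; _-_; ⊤; inside; outside)
open import Data.Fin.Subset.Properties
  using (_∈?_; x∈⁅x⁆; x∈⁅y⁆⇒x≡y; ∣⁅x⁆∣≡1; x∈p∪q⁺; x∈p∪q⁻; p─⊥≡p; p─q⊆p; x∈p∧x≢y⇒x∈p-y; ∈⊤; ∣⊤∣≡n)
open import Data.Nat using (ℕ; zero; suc; _+_; _≤_; _<ᵇ_; z≤n; s≤s)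
open import Data.Nat.Divisibility using (_∣_; _∣0; ∣-refl; ∣m∣n⇒∣m+n)
open import Data.Nat.Properties using (<⇒<ᵇ; ≤-refl; ≤-antisym; ≤-trans; ≤-reflexive; +-suc; +-mono-≤; m≤n⇒m≤1+n; suc-injective)
open import Data.Product using (Σ; _×_; _,_; proj₁; proj₂)
import Data.Product as Product
open import Data.Sum using (_⊎_; inj₁; inj₂)
import Data.Sum as Sum
open import Data.Vec using ([]; _∷_; tabulate; here; there)
open import Data.Vec.Properties using (lookup⇒[]=; []=⇒lookup; lookup∘tabulate)
open import Function using (_∘_)
open import Function.Bundles using (Equivalence)
open import Relation.Binary.PropositionalEquality
  using (_≡_; _≢_; refl; sym; trans; cong; cong₂; subst; subst₂; ≢-sym; module ≡-Reasoning)
open import Relation.Nullary using (¬_; Dec; yes; no; ⌊_⌋; contradiction)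
open import Relation.Nullary.Decidable using (T?; _⊎-dec_; map′; fromWitness; toWitness)
open import Relation.Unary using (Decidable)

open import Defs

open Equivalence using (to; from)

private variable
  n : ℕ

≢-resp : {A : Set} {x x′ y y′ : A} → x ≡ x′ → y ≡ y′ → x′ ≢ y′ → x ≢ y
≢-resp refl refl x′≢y′ = x′≢y′

∣p∣≡1+∣p-x∣ : {x : Fin n} {p : Subset n} → x ∈ p → ∣ p ∣ ≡ suc ∣ p - x ∣
∣p∣≡1+∣p-x∣ {x = zero}  {inside ∷ p}  here      = cong (suc ∘ ∣_∣) (sym (p─⊥≡p p))
∣p∣≡1+∣p-x∣ {x = suc x} {inside ∷ p}  (there m) = cong suc (∣p∣≡1+∣p-x∣ m)
∣p∣≡1+∣p-x∣ {x = suc x} {outside ∷ p} (there m) = ∣p∣≡1+∣p-x∣ m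

x∉p-x : (x : Fin n) (p : Subset n) → x ∉ p - x
x∉p-x zero    (s ∷ p) ()
x∉p-x (suc x) (s ∷ p) (there m) = x∉p-x x p m

∈p-x⁻ : {x y : Fin n} {p : Subset n} → y ∈ p - x → y ∈ p × y ≢ x
∈p-x⁻ {x = x} {p = p} m = p─q⊆p p ⁅ x ⁆ m , λ { refl → x∉p-x x p m }

1≤∣p∣ : {x : Fin n} {p : Subset n} → x ∈ p → 1 ≤ ∣ p ∣
1≤∣p∣ x∈p rewrite ∣p∣≡1+∣p-x∣ x∈p = s≤s z≤n

2≤∣p∣ : {x y : Fin n} {p : Subset n} → x ∈ p → y ∈ p → x ≢ y → 2 ≤ ∣ p ∣
2≤∣p∣ x∈p y∈p x≢y rewrite ∣p∣≡1+∣p-x∣ x∈p =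
  s≤s (1≤∣p∣ (x∈p∧x≢y⇒x∈p-y y∈p (≢-sym x≢y)))

3≤∣p∣ : {x y z : Fin n} {p : Subset n} → x ∈ p → y ∈ p → z ∈ p →
        x ≢ y → x ≢ z → y ≢ z → 3 ≤ ∣ p ∣
3≤∣p∣ x∈p y∈p z∈p x≢y x≢z y≢z rewrite ∣p∣≡1+∣p-x∣ x∈p =
  s≤s (2≤∣p∣ (x∈p∧x≢y⇒x∈p-y y∈p (≢-sym x≢y)) (x∈p∧x≢y⇒x∈p-y z∈p (≢-sym x≢z)) y≢z)

member : (p : Subset n) {k : ℕ} → ∣ p ∣ ≡ suc k → Σ (Fin n) (_∈ p)
member (inside  ∷ p) _ = zero , here
member (outside ∷ p) |p|≡1+k with member p |p|≡1+k
... | x , x∈p = suc x , there x∈p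

∣p∪q∣≤∣p∣+∣q∣ : (p q : Subset n) → ∣ p ∪ q ∣ ≤ ∣ p ∣ + ∣ q ∣
∣p∪q∣≤∣p∣+∣q∣ []            []            = z≤n
∣p∪q∣≤∣p∣+∣q∣ (inside  ∷ p) (inside  ∷ q) =
  s≤s (subst (∣ p ∪ q ∣ ≤_) (sym (+-suc ∣ p ∣ ∣ q ∣)) (m≤n⇒m≤1+n (∣p∪q∣≤∣p∣+∣q∣ p q)))
∣p∪q∣≤∣p∣+∣q∣ (inside  ∷ p) (outside ∷ q) = s≤s (∣p∪q∣≤∣p∣+∣q∣ p q)
∣p∪q∣≤∣p∣+∣q∣ (outside ∷ p) (inside  ∷ q) =
  subst (suc ∣ p ∪ q ∣ ≤_) (sym (+-suc ∣ p ∣ ∣ q ∣)) (s≤s (∣p∪q∣≤∣p∣+∣q∣ p q))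
∣p∪q∣≤∣p∣+∣q∣ (outside ∷ p) (outside ∷ q) = ∣p∪q∣≤∣p∣+∣q∣ p q

pair : Fin n → Fin n → Subset n
pair a b = ⁅ a ⁆ ∪ ⁅ b ⁆

triple : Fin n → Fin n → Fin n → Subset n
triple a b c = pair a b ∪ ⁅ c ⁆

∣pair∣≤2 : (a b : Fin n) → ∣ pair a b ∣ ≤ 2
∣pair∣≤2 a b = ≤-trans (∣p∪q∣≤∣p∣+∣q∣ ⁅ a ⁆ ⁅ b ⁆) (≤-reflexive (cong₂ _+_ (∣⁅x⁆∣≡1 a) (∣⁅x⁆∣≡1 b)))

∣triple∣≤3 : (a b c : Fin n) → ∣ triple a b c ∣ ≤ 3
∣triple∣≤3 a b c =
  ≤-trans (∣p∪q∣≤∣p∣+∣q∣ (pair a b) ⁅ c ⁆) (+-mono-≤ (∣pair∣≤2 a b) (≤-reflexive (∣⁅x⁆∣≡1 c)))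

∈pair₁ : (a b : Fin n) → a ∈ pair a b
∈pair₁ a b = x∈p∪q⁺ (inj₁ (x∈⁅x⁆ a))

∈pair₂ : (a b : Fin n) → b ∈ pair a b
∈pair₂ a b = x∈p∪q⁺ {p = ⁅ a ⁆} (inj₂ (x∈⁅x⁆ b))

∈pair⁻ : {a b x : Fin n} → x ∈ pair a b → x ≡ a ⊎ x ≡ b
∈pair⁻ {a = a} {b} m with x∈p∪q⁻ ⁅ a ⁆ ⁅ b ⁆ m
... | inj₁ x∈a = inj₁ (x∈⁅y⁆⇒x≡y a x∈a)
... | inj₂ x∈b = inj₂ (x∈⁅y⁆⇒x≡y b x∈b)

∈triple₁ : (a b c : Fin n) → a ∈ triple a b c
∈triple₁ a b c = x∈p∪q⁺ (inj₁ (∈pair₁ a b))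

∈triple₂ : (a b c : Fin n) → b ∈ triple a b c
∈triple₂ a b c = x∈p∪q⁺ (inj₁ (∈pair₂ a b))

∈triple₃ : (a b c : Fin n) → c ∈ triple a b c
∈triple₃ a b c = x∈p∪q⁺ {p = pair a b} (inj₂ (x∈⁅x⁆ c))

∈triple⁻ : {a b c x : Fin n} → x ∈ triple a b c → x ≡ a ⊎ x ≡ b ⊎ x ≡ c
∈triple⁻ {a = a} {b} {c} m with x∈p∪q⁻ (pair a b) ⁅ c ⁆ m
... | inj₂ x∈c = inj₂ (inj₂ (x∈⁅y⁆⇒x≡y c x∈c))
... | inj₁ x∈ab with ∈pair⁻ x∈ab
...   | inj₁ x≡a = inj₁ x≡a
...   | inj₂ x≡b = inj₂ (inj₁ x≡b)

∈-tabulate⁺ : (f : Fin n → Bool) {x : Fin n} → T (f x) → x ∈ tabulate f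
∈-tabulate⁺ f {x} fx = lookup⇒[]= x (tabulate f) (trans (lookup∘tabulate f x) (to T-≡ fx))

∈-tabulate⁻ : (f : Fin n → Bool) {x : Fin n} → x ∈ tabulate f → T (f x)
∈-tabulate⁻ f {x} m = from T-≡ (trans (sym (lookup∘tabulate f x)) ([]=⇒lookup m))

FixedPointFreeInvolution : (Fin n → Fin n) → Subset n → Set
FixedPointFreeInvolution g S = ∀ v → v ∈ S → g v ∈ S × g v ≢ v × g (g v) ≡ v

involution-remove : (g : Fin n → Fin n) (S : Subset n) → FixedPointFreeInvolution g S →
                    ∀ {v} → v ∈ S → FixedPointFreeInvolution g (S - v - g v)
involution-remove g S inv {v} v∈S w w∈S′ with ∈p-x⁻ w∈S′
... | w∈S-v , w≢gv with ∈p-x⁻ w∈S-v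
...   | w∈S , w≢v with inv w w∈S | inv v v∈S
...     | gw∈S , gw≢w , ggw≡w | _ , _ , ggv≡v =
  x∈p∧x≢y⇒x∈p-y (x∈p∧x≢y⇒x∈p-y gw∈S gw≢v) gw≢gv , gw≢w , ggw≡w
  where
  gw≢v : g w ≢ v
  gw≢v gw≡v = w≢gv (trans (sym ggw≡w) (cong g gw≡v))
  gw≢gv : g w ≢ g v
  gw≢gv gw≡gv = w≢v (trans (sym ggw≡w) (trans (cong g gw≡gv) ggv≡v))

-- A set carrying a fixed-point-free involution has even size: the
-- involution splits it into pairs {v, g v}.
involution⇒even : (g : Fin n → Fin n) (k : ℕ) (S : Subset n) → ∣ S ∣ ≡ k →
                  FixedPointFreeInvolution g S → 2 ∣ k
involution⇒even g zero          S _     _   = 2 ∣0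
involution⇒even g (suc zero)    S |S|≡1 inv with member S |S|≡1
... | v , v∈S with inv v v∈S
...   | gv∈S , gv≢v , _ with ≤-trans (2≤∣p∣ v∈S gv∈S (≢-sym gv≢v)) (≤-reflexive |S|≡1)
...     | s≤s ()
involution⇒even g (suc (suc k)) S |S|≡2+k inv with member S |S|≡2+k
... | v , v∈S = ∣m∣n⇒∣m+n ∣-refl (involution⇒even g k (S - v - g v) |S′|≡k (involution-remove g S inv v∈S))
  where
  gv∈S-v : g v ∈ S - v
  gv∈S-v = x∈p∧x≢y⇒x∈p-y (proj₁ (inv v v∈S)) (proj₁ (proj₂ (inv v v∈S)))
  |S′|≡k : ∣ S - v - g v ∣ ≡ k
  |S′|≡k = suc-injective (suc-injective (begin
    suc (suc ∣ S - v - g v ∣) ≡⟨ cong suc (sym (∣p∣≡1+∣p-x∣ gv∈S-v)) ⟩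
    suc ∣ S - v ∣             ≡⟨ sym (∣p∣≡1+∣p-x∣ v∈S) ⟩
    ∣ S ∣                     ≡⟨ |S|≡2+k ⟩
    suc (suc k)               ∎))
    where open ≡-Reasoning

Dominates : Graph n → Fin n → Fin n → Set
Dominates G u v = u ≡ v ⊎ Edge G u v

dominates? : (G : Graph n) (u v : Fin n) → Dec (Dominates G u v)
dominates? G u v = (u ≟ v) ⊎-dec T? (G u v)

_⊆ᴱ_ : Graph n → Graph n → Set
G ⊆ᴱ H = ∀ {x y} → Edge G x y → Edge H x y

module _ {G : Graph n} {D : Subset n} where

  dominator : Dominating G D → ∀ v → Σ (Fin n) λ u → u ∈ D × Dominates G u v
  dominator dom v with dom v
  ... | inj₁ v∈D           = v , v∈D , inj₁ refl
  ... | inj₂ (u , u∈D , e) = u , u∈D , inj₂ e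

  dominated : ∀ {u v} → u ∈ D → Dominates G u v → v ∈ D ⊎ Σ (Fin n) (λ w → w ∈ D × Edge G w v)
  dominated u∈D (inj₁ refl) = inj₁ u∈D
  dominated u∈D (inj₂ e)    = inj₂ (_ , u∈D , e)

  reach-start : ∀ {u v} → Reach G D u v → u ∈ D
  reach-start (here u∈D)     = u∈D
  reach-start (step u∈D _ _) = u∈D

  reach-trans : ∀ {u v w} → Reach G D u v → Reach G D v w → Reach G D u w
  reach-trans (here _)       r = r
  reach-trans (step u∈D e p) r = step u∈D e (reach-trans p r)

  edge-reach : ∀ {u v} → u ∈ D → v ∈ D → Edge G u v → Reach G D u v
  edge-reach u∈D v∈D e = step u∈D e (here v∈D)

  hub-connected : ∀ {h} → (∀ u → u ∈ D → Reach G D u h × Reach G D h u) → InducedConnected G D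
  hub-connected hub u v u∈D v∈D = reach-trans (proj₁ (hub u u∈D)) (proj₂ (hub v v∈D))

  exit : (P : Fin n → Set) → Decidable P → ∀ {u v} → Reach G D u v → P u → ¬ P v →
         Σ (Fin n) λ a → Σ (Fin n) λ b → b ∈ D × Edge G a b × P a × ¬ P b
  exit P P? (here _) pu ¬pv = contradiction pu ¬pv
  exit P P? (step {w = w} _ e r) pu ¬pv with P? w
  ... | yes pw = exit P P? r pw ¬pv
  ... | no ¬pw = _ , w , reach-start r , e , pu , ¬pw

cds-mono : {G H : Graph n} {D : Subset n} → G ⊆ᴱ H → IsCDS G D → IsCDS H D
cds-mono {G = G} {H} {D} G⊆H (dom , con) = dom′ , λ u v u∈D v∈D → reach-mono (con u v u∈D v∈D)
  where
  dom′ : Dominating H D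
  dom′ v with dom v
  ... | inj₁ v∈D           = inj₁ v∈D
  ... | inj₂ (u , u∈D , e) = inj₂ (u , u∈D , G⊆H e)
  reach-mono : ∀ {u v} → Reach G D u v → Reach H D u v
  reach-mono (here u∈D)     = here u∈D
  reach-mono (step u∈D e r) = step u∈D (G⊆H e) (reach-mono r)

module _ {G : Graph n} where

  pair-cds : ∀ {a b} → Edge G a b → Edge G b a →
             (∀ v → Dominates G a v ⊎ Dominates G b v) → IsCDS G (pair a b)
  pair-cds {a} {b} ab ba dom = domination , hub-connected hub
    where
    domination : Dominating G (pair a b)
    domination v with dom v
    ... | inj₁ av = dominated {G = G} (∈pair₁ a b) av
    ... | inj₂ bv = dominated {G = G} (∈pair₂ a b) bv
    hub : ∀ u → u ∈ pair a b → Reach G (pair a b) u a × Reach G (pair a b) a u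
    hub u u∈D with ∈pair⁻ u∈D
    ... | inj₁ refl = here u∈D , here u∈D
    ... | inj₂ refl = edge-reach u∈D (∈pair₁ a b) ba , edge-reach (∈pair₁ a b) u∈D ab

  path-cds : ∀ {a b c} → Edge G a b → Edge G b a → Edge G b c → Edge G c b →
             (∀ v → Dominates G a v ⊎ Dominates G b v ⊎ Dominates G c v) →
             IsCDS G (triple a b c)
  path-cds {a} {b} {c} ab ba bc cb dom = domination , hub-connected hub
    where
    domination : Dominating G (triple a b c)
    domination v with dom v
    ... | inj₁ av        = dominated {G = G} (∈triple₁ a b c) av
    ... | inj₂ (inj₁ bv) = dominated {G = G} (∈triple₂ a b c) bv
    ... | inj₂ (inj₂ cv) = dominated {G = G} (∈triple₃ a b c) cv
    b∈D = ∈triple₂ a b c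
    hub : ∀ u → u ∈ triple a b c → Reach G (triple a b c) u b × Reach G (triple a b c) b u
    hub u u∈D with ∈triple⁻ u∈D
    ... | inj₁ refl        = edge-reach u∈D b∈D ab , edge-reach b∈D u∈D ba
    ... | inj₂ (inj₁ refl) = here u∈D , here u∈D
    ... | inj₂ (inj₂ refl) = edge-reach u∈D b∈D cb , edge-reach b∈D u∈D bc

  2≤dominating : Fin n → (∀ c → Σ (Fin n) λ w → ¬ Dominates G c w) →
                 ∀ {D} → Dominating G D → 2 ≤ ∣ D ∣
  2≤dominating v₀ undominated dom with dominator dom v₀
  ... | c , c∈D , _ with undominated c
  ... | w , ¬cw with dominator dom w
  ... | c′ , c′∈D , c′w = 2≤∣p∣ c∈D c′∈D λ { refl → ¬cw c′w }

  gammaC-intro : ∀ {D k} → IsCDS G D → ∣ D ∣ ≤ k → (∀ D′ → IsCDS G D′ → k ≤ ∣ D′ ∣) → GammaC G k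
  gammaC-intro {D} cds ≤k lower = (D , cds , ≤-antisym ≤k (lower D cds)) , lower

  γc-set-intro : ∀ {D k} → IsCDS G D → ∣ D ∣ ≤ k → (∀ D′ → IsCDS G D′ → k ≤ ∣ D′ ∣) →
                 IsGammaCSet G D
  γc-set-intro cds ≤k lower = cds , λ D′ cds′ → ≤-trans ≤k (lower D′ cds′)

  3≤degree : ∀ v a b c → Edge G v a → Edge G v b → Edge G v c →
             a ≢ b → a ≢ c → b ≢ c → 3 ≤ degree G v
  3≤degree v a b c va vb vc = 3≤∣p∣ (∈-tabulate⁺ (G v) va) (∈-tabulate⁺ (G v) vb) (∈-tabulate⁺ (G v) vc)

bool-pigeonhole : (x y z : Bool) → x ≡ y ⊎ x ≡ z ⊎ y ≡ z
bool-pigeonhole false false _     = inj₁ refl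
bool-pigeonhole true  true  _     = inj₁ refl
bool-pigeonhole false true  false = inj₂ (inj₁ refl)
bool-pigeonhole false true  true  = inj₂ (inj₂ refl)
bool-pigeonhole true  false false = inj₂ (inj₂ refl)
bool-pigeonhole true  false true  = inj₂ (inj₁ refl)

-- If the neighbours of every vertex c are 2-coloured by side c so that
-- equally coloured neighbours are adjacent (N(c) is covered by two
-- cliques), then G is claw-free: two of any three neighbours share a colour.
two-cliques⇒claw-free : (G : Graph n) (side : Fin n → Fin n → Bool) →
  (∀ c a b → Edge G c a → Edge G c b → a ≢ b → side c a ≡ side c b → Edge G a b) →
  ClawFree G
two-cliques⇒claw-free G side clique c a b d ca cb cd a≢b a≢d b≢d (¬ab , ¬ad , ¬bd)
  with bool-pigeonhole (side c a) (side c b) (side c d)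
... | inj₁ same        = ¬ab (clique c a b ca cb a≢b same)
... | inj₂ (inj₁ same) = ¬ad (clique c a d ca cd a≢d same)
... | inj₂ (inj₂ same) = ¬bd (clique c b d cb cd b≢d same)

-- A set W of t vertices outside S (the image of an injection ι) whose
-- neighbours outside S all lie in W must have even size if G - S has a
-- perfect matching: the matching pairs W off within itself.
closed-set-even : (G : Graph n) (S : Subset n) {t : ℕ} (ι : Fin t → Fin n) →
  (∀ {i j} → ι i ≡ ι j → i ≡ j) → (∀ {u v} → Edge G u v → u ≢ v) → (∀ i → ι i ∉ S) →
  (∀ i w → w ∉ S → Edge G (ι i) w → Σ (Fin t) λ j → w ≡ ι j) →
  PerfectMatchingMinus G S → 2 ∣ t
closed-set-even G S {t} ι ι-injective loopless ι∉S closed (m , matched) =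
  involution⇒even g t ⊤ (∣⊤∣≡n t) λ i _ → ∈⊤ , g-moves i , g-involutive i
  where
  partner : ∀ i → Σ (Fin t) λ j → m (ι i) ≡ ι j
  partner i with matched (ι i) (ι∉S i)
  ... | m∉S , e , _ = closed i (m (ι i)) m∉S e
  g : Fin t → Fin t
  g i = proj₁ (partner i)
  ι∘g : ∀ i → ι (g i) ≡ m (ι i)
  ι∘g i = sym (proj₂ (partner i))
  g-moves : ∀ i → g i ≢ i
  g-moves i gi≡i = loopless (proj₁ (proj₂ (matched (ι i) (ι∉S i))))
                            (sym (trans (sym (ι∘g i)) (cong ι gi≡i)))
  g-involutive : ∀ i → g (g i) ≡ i
  g-involutive i = ι-injective (begin
    ι (g (g i)) ≡⟨ ι∘g (g i) ⟩
    m (ι (g i)) ≡⟨ cong m (ι∘g i) ⟩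
    m (m (ι i)) ≡⟨ proj₂ (proj₂ (matched (ι i) (ι∉S i))) ⟩
    ι i         ∎)
    where open ≡-Reasoning

≟∧≟⁺ : {a b c d : Fin n} → a ≡ b → c ≡ d → T (⌊ a ≟ b ⌋ ∧ ⌊ c ≟ d ⌋)
≟∧≟⁺ {a = a} {b} a≡b c≡d = from (T-∧ {⌊ a ≟ b ⌋}) (fromWitness a≡b , fromWitness c≡d)

≟∧≟⁻ : {a b c d : Fin n} → T (⌊ a ≟ b ⌋ ∧ ⌊ c ≟ d ⌋) → a ≡ b × c ≡ d
≟∧≟⁻ {a = a} {b} t = Product.map toWitness toWitness (to (T-∧ {⌊ a ≟ b ⌋}) t)

module _ {G : Graph n} {u v : Fin n} where

  addEdge-⊇ : G ⊆ᴱ addEdge G u v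
  addEdge-⊇ {x} {y} e = from (T-∨ {G x y}) (inj₁ e)

  addEdge-new : Edge (addEdge G u v) u v
  addEdge-new = from (T-∨ {G u v}) (inj₂ (from (T-∨ {⌊ u ≟ u ⌋ ∧ ⌊ v ≟ v ⌋}) (inj₁ (≟∧≟⁺ {a = u} {c = v} refl refl))))

  addEdge-new′ : Edge (addEdge G u v) v u
  addEdge-new′ = from (T-∨ {G v u}) (inj₂ (from (T-∨ {⌊ v ≟ u ⌋ ∧ ⌊ u ≟ v ⌋}) (inj₂ (≟∧≟⁺ {a = v} {c = u} refl refl))))

  addEdge⁻ : ∀ {x y} → Edge (addEdge G u v) x y → Edge G x y ⊎ (x ≡ u × y ≡ v) ⊎ (x ≡ v × y ≡ u)
  addEdge⁻ {x} {y} e with to (T-∨ {G x y}) e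
  ... | inj₁ old = inj₁ old
  ... | inj₂ new = inj₂ (Sum.map ≟∧≟⁻ ≟∧≟⁻ (to (T-∨ {⌊ x ≟ u ⌋ ∧ ⌊ y ≟ v ⌋}) new))

  add-one-edge : ∀ {c w₁ w₂} → w₁ ≢ w₂ → ¬ Dominates G c w₁ → ¬ Dominates G c w₂ →
                 Σ (Fin n) λ w → ¬ Dominates (addEdge G u v) c w
  add-one-edge {c} {w₁} {w₂} w₁≢w₂ ¬d₁ ¬d₂
    with dominates? (addEdge G u v) c w₁ | dominates? (addEdge G u v) c w₂
  ... | no ¬d₁′ | _       = w₁ , ¬d₁′
  ... | yes _   | no ¬d₂′ = w₂ , ¬d₂′
  ... | yes d₁  | yes d₂  = ⊥-elim (both-new (new d₁ ¬d₁) (new d₂ ¬d₂))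
    where
    new : ∀ {w} → Dominates (addEdge G u v) c w → ¬ Dominates G c w →
          (c ≡ u × w ≡ v) ⊎ (c ≡ v × w ≡ u)
    new (inj₁ c≡w) ¬d = ⊥-elim (¬d (inj₁ c≡w))
    new (inj₂ e)   ¬d with addEdge⁻ e
    ... | inj₁ old = ⊥-elim (¬d (inj₂ old))
    ... | inj₂ uv  = uv
    both-new : (c ≡ u × w₁ ≡ v) ⊎ (c ≡ v × w₁ ≡ u) → (c ≡ u × w₂ ≡ v) ⊎ (c ≡ v × w₂ ≡ u) → ⊥
    both-new (inj₁ (_ , w₁≡v))   (inj₁ (_ , w₂≡v))   = w₁≢w₂ (trans w₁≡v (sym w₂≡v))
    both-new (inj₂ (_ , w₁≡u))   (inj₂ (_ , w₂≡u))   = w₁≢w₂ (trans w₁≡u (sym w₂≡u))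
    both-new (inj₁ (c≡u , _))    (inj₂ (_ , w₂≡u))   = ¬d₂ (inj₁ (trans c≡u (sym w₂≡u)))
    both-new (inj₂ (_ , w₁≡u))   (inj₁ (c≡u , _))    = ¬d₁ (inj₁ (trans c≡u (sym w₁≡u)))

dominating-pair : {G : Graph n} {u v : Fin n} → (∀ w → Dominates G u w ⊎ Dominates G v w) →
                  IsCDS (addEdge G u v) (pair u v)
dominating-pair {G = G} {u} {v} dom =
  pair-cds (addEdge-new {G = G}) (addEdge-new′ {G = G}) λ w → Sum.map lift lift (dom w)
  where
  lift : ∀ {x w} → Dominates G x w → Dominates (addEdge G u v) x w
  lift = Sum.map₂ (addEdge-⊇ {G = G})

addEdge-comm : {G : Graph n} {u v : Fin n} → addEdge G v u ⊆ᴱ addEdge G u v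
addEdge-comm {G = G} {u} {v} e with addEdge⁻ {G = G} e
... | inj₁ old                  = addEdge-⊇ {G = G} old
... | inj₂ (inj₁ (refl , refl)) = addEdge-new′ {G = G}
... | inj₂ (inj₂ (refl , refl)) = addEdge-new {G = G}

-- The parts of 𝒜(t₁, t₂) form the 5-cycle X1 - K1 - X2 - X3 - K2 - X1,
-- with loops at the clique parts K1 and K2.

code : Part → Fin 5
code X1 = zero
code X2 = suc zero
code X3 = suc (suc zero)
code K1 = suc (suc (suc zero))
code K2 = suc (suc (suc (suc zero)))

code-injective : ∀ {p q} → code p ≡ code q → p ≡ q
code-injective {X1} {X1} refl = refl
code-injective {X2} {X2} refl = refl
code-injective {X3} {X3} refl = refl
code-injective {K1} {K1} refl = refl
code-injective {K2} {K2} refl = refl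

_≟ₚ_ : (p q : Part) → Dec (p ≡ q)
p ≟ₚ q = map′ code-injective (cong code) (code p ≟ code q)

Near : Part → Part → Set
Near p q = p ≡ q ⊎ T (partEdge p q)

partEdge-sym : ∀ p q → T (partEdge p q) → T (partEdge q p)
partEdge-sym X1 K1 _ = _
partEdge-sym X1 K2 _ = _
partEdge-sym X2 K1 _ = _
partEdge-sym X2 X3 _ = _
partEdge-sym X3 X2 _ = _
partEdge-sym X3 K2 _ = _
partEdge-sym K1 X1 _ = _
partEdge-sym K1 X2 _ = _
partEdge-sym K1 K1 _ = _
partEdge-sym K2 X1 _ = _
partEdge-sym K2 X3 _ = _
partEdge-sym K2 K2 _ = _

far : ∀ {p q} → p ≢ q → ¬ T (partEdge p q) → ¬ Near p q
far p≢q _  (inj₁ p≡q) = p≢q p≡q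
far _   ¬e (inj₂ e)   = ¬e e

away : ∀ {p q r} → ¬ Near p q → Near r q → r ≢ p
away ¬near near refl = ¬near near

neighbours-X2 : ∀ {p} → T (partEdge X2 p) → p ≡ K1 ⊎ p ≡ X3
neighbours-X2 {K1} _ = inj₁ refl
neighbours-X2 {X3} _ = inj₂ refl

neighbours-X3 : ∀ {p} → T (partEdge X3 p) → p ≡ K2 ⊎ p ≡ X2
neighbours-X3 {K2} _ = inj₁ refl
neighbours-X3 {X2} _ = inj₂ refl

neighbours-K1 : ∀ {p} → T (partEdge K1 p) → p ≢ K1 → p ≡ X1 ⊎ p ≡ X2
neighbours-K1 {X1} _ _    = inj₁ refl
neighbours-K1 {X2} _ _    = inj₂ refl
neighbours-K1 {K1} _ ≢K1 = contradiction refl ≢K1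

-- The neighbourhood of a part splits into two cliques; side c marks the
-- clique containing a neighbour part of c.
side : Part → Part → Bool
side X1 K2 = true
side X2 X3 = true
side X3 K2 = true
side K1 X2 = true
side K2 X3 = true
side _  _  = false

side-clique : ∀ c p q → T (partEdge c p) → T (partEdge c q) → side c p ≡ side c q → Near p q
side-clique X1 K1 K1 _ _ _ = inj₁ refl
side-clique X1 K2 K2 _ _ _ = inj₁ refl
side-clique X2 K1 K1 _ _ _ = inj₁ refl
side-clique X2 X3 X3 _ _ _ = inj₁ refl
side-clique X3 X2 X2 _ _ _ = inj₁ refl
side-clique X3 K2 K2 _ _ _ = inj₁ refl
side-clique K1 X1 X1 _ _ _ = inj₁ refl
side-clique K1 X1 K1 _ _ _ = inj₂ _
side-clique K1 K1 X1 _ _ _ = inj₂ _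
side-clique K1 K1 K1 _ _ _ = inj₁ refl
side-clique K1 X2 X2 _ _ _ = inj₁ refl
side-clique K2 X1 X1 _ _ _ = inj₁ refl
side-clique K2 X1 K2 _ _ _ = inj₂ _
side-clique K2 K2 X1 _ _ _ = inj₂ _
side-clique K2 K2 K2 _ _ _ = inj₁ refl
side-clique K2 X3 X3 _ _ _ = inj₁ refl

inH : Part → Bool
inH X1 = true
inH K1 = true
inH _  = false

inH-near : ∀ p q → T (inH p) → T (inH q) → Near p q
inH-near X1 X1 _ _ = inj₁ refl
inH-near X1 K1 _ _ = inj₂ _
inH-near K1 X1 _ _ = inj₂ _
inH-near K1 K1 _ _ = inj₁ refl

-- m + n is never below m; this places the vertices k₂ j in part K2.
m+n<ᵇm : ∀ m n → ((m + n) <ᵇ m) ≡ false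
m+n<ᵇm zero    n = refl
m+n<ᵇm (suc m) n = m+n<ᵇm m n

another : ∀ {m} (i : Fin (2 + m)) → Σ (Fin (2 + m)) λ i′ → i ≢ i′
another zero    = suc zero , λ ()
another (suc i) = zero , λ ()

-- The graph 𝒜(t₁, t₂) with t₁ = 2 + a and t₂ = 2 + b.

module 𝒜-Properties (a b : ℕ) where

  t₁ t₂ N : ℕ
  t₁ = 2 + a
  t₂ = 2 + b
  N  = 3 + t₁ + t₂

  G : Graph N
  G = 𝒜 t₁ t₂

  E : Fin N → Fin N → Set
  E = Edge G

  pt : Fin N → Part
  pt = part t₁ t₂

  x₁ x₂ x₃ : Fin N
  x₁ = zero
  x₂ = suc zero
  x₃ = suc (suc zero)

  k₁ : Fin t₁ → Fin N
  k₁ i = suc (suc (suc (i ↑ˡ t₂)))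

  k₂ : Fin t₂ → Fin N
  k₂ j = suc (suc (suc (t₁ ↑ʳ j)))

  data Vertex : Fin N → Set where
    x₁ᵛ : Vertex x₁
    x₂ᵛ : Vertex x₂
    x₃ᵛ : Vertex x₃
    k₁ᵛ : ∀ i → Vertex (k₁ i)
    k₂ᵛ : ∀ j → Vertex (k₂ j)

  view : ∀ v → Vertex v
  view zero                = x₁ᵛ
  view (suc zero)          = x₂ᵛ
  view (suc (suc zero))    = x₃ᵛ
  view (suc (suc (suc w))) =
    subst (λ z → Vertex (suc (suc (suc z)))) (join-splitAt t₁ t₂ w) (block (splitAt t₁ w))
    where
    block : (s : Fin t₁ ⊎ Fin t₂) → Vertex (suc (suc (suc (join t₁ t₂ s))))
    block (inj₁ i) = k₁ᵛ i
    block (inj₂ j) = k₂ᵛ j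

  k₁-injective : ∀ {i j} → k₁ i ≡ k₁ j → i ≡ j
  k₁-injective {i} {j} e = ↑ˡ-injective t₂ i j (Fin.suc-injective (Fin.suc-injective (Fin.suc-injective e)))

  k₂-injective : ∀ {i j} → k₂ i ≡ k₂ j → i ≡ j
  k₂-injective {i} {j} e = ↑ʳ-injective t₁ i j (Fin.suc-injective (Fin.suc-injective (Fin.suc-injective e)))

  pt-k₁ : ∀ i → pt (k₁ i) ≡ K1
  pt-k₁ i rewrite toℕ-↑ˡ i t₂ | to T-≡ (<⇒<ᵇ (toℕ<n i)) = refl

  pt-k₂ : ∀ j → pt (k₂ j) ≡ K2
  pt-k₂ j rewrite toℕ-↑ʳ a j | m+n<ᵇm a (toℕ j) = refl

  edge-intro : ∀ {u v} → u ≢ v → T (partEdge (pt u) (pt v)) → E u v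
  edge-intro {u} {v} u≢v e with u ≟ v
  ... | yes u≡v = contradiction u≡v u≢v
  ... | no  _   = e

  edge-parts : ∀ u v → E u v → T (partEdge (pt u) (pt v))
  edge-parts u v e with u ≟ v
  ... | no _ = e

  edge-distinct : ∀ u v → E u v → u ≢ v
  edge-distinct u v e with u ≟ v
  ... | no u≢v = u≢v

  edge-by-parts : ∀ u v {p q} → pt u ≡ p → pt v ≡ q → p ≢ q → T (partEdge p q) → E u v
  edge-by-parts u v refl refl p≢q e = edge-intro {u} {v} (p≢q ∘ cong pt) e

  non-edge-by-parts : ∀ u v {p q} → pt u ≡ p → pt v ≡ q → ¬ T (partEdge p q) → ¬ E u v
  non-edge-by-parts u v refl refl ¬e = ¬e ∘ edge-parts u v

  x₁~k₁ : ∀ i → E x₁ (k₁ i)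
  x₁~k₁ i = edge-by-parts x₁ (k₁ i) refl (pt-k₁ i) (λ ()) _

  x₁~k₂ : ∀ j → E x₁ (k₂ j)
  x₁~k₂ j = edge-by-parts x₁ (k₂ j) refl (pt-k₂ j) (λ ()) _

  x₂~k₁ : ∀ i → E x₂ (k₁ i)
  x₂~k₁ i = edge-by-parts x₂ (k₁ i) refl (pt-k₁ i) (λ ()) _

  x₂~x₃ : E x₂ x₃
  x₂~x₃ = edge-by-parts x₂ x₃ refl refl (λ ()) _

  x₃~k₂ : ∀ j → E x₃ (k₂ j)
  x₃~k₂ j = edge-by-parts x₃ (k₂ j) refl (pt-k₂ j) (λ ()) _

  k₁~x₁ : ∀ i → E (k₁ i) x₁
  k₁~x₁ i = edge-by-parts (k₁ i) x₁ (pt-k₁ i) refl (λ ()) _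

  k₂~x₁ : ∀ j → E (k₂ j) x₁
  k₂~x₁ j = edge-by-parts (k₂ j) x₁ (pt-k₂ j) refl (λ ()) _

  k₁~x₂ : ∀ i → E (k₁ i) x₂
  k₁~x₂ i = edge-by-parts (k₁ i) x₂ (pt-k₁ i) refl (λ ()) _

  x₃~x₂ : E x₃ x₂
  x₃~x₂ = edge-by-parts x₃ x₂ refl refl (λ ()) _

  k₂~x₃ : ∀ j → E (k₂ j) x₃
  k₂~x₃ j = edge-by-parts (k₂ j) x₃ (pt-k₂ j) refl (λ ()) _

  k₁~k₁ : ∀ {i i′} → i ≢ i′ → E (k₁ i) (k₁ i′)
  k₁~k₁ {i} {i′} i≢i′ =
    edge-intro {k₁ i} (i≢i′ ∘ k₁-injective) (subst₂ (λ p q → T (partEdge p q)) (sym (pt-k₁ i)) (sym (pt-k₁ i′)) _)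

  k₂~k₂ : ∀ {j j′} → j ≢ j′ → E (k₂ j) (k₂ j′)
  k₂~k₂ {j} {j′} j≢j′ =
    edge-intro {k₂ j} (j≢j′ ∘ k₂-injective) (subst₂ (λ p q → T (partEdge p q)) (sym (pt-k₂ j)) (sym (pt-k₂ j′)) _)

  k₁-dominates : ∀ i i′ → Dominates G (k₁ i) (k₁ i′)
  k₁-dominates i i′ with i Fin.≟ i′
  ... | yes refl  = inj₁ refl
  ... | no  i≢i′ = inj₂ (k₁~k₁ i≢i′)

  k₂-dominates : ∀ j j′ → Dominates G (k₂ j) (k₂ j′)
  k₂-dominates j j′ with j Fin.≟ j′
  ... | yes refl  = inj₁ refl
  ... | no  j≢j′ = inj₂ (k₂~k₂ j≢j′)

  rep : Part → Fin N
  rep X1 = x₁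
  rep X2 = x₂
  rep X3 = x₃
  rep K1 = k₁ zero
  rep K2 = k₂ zero

  singleton : ∀ v → ¬ T (partEdge (pt v) (pt v)) → v ≡ rep (pt v)
  singleton v ¬clique with view v
  ... | x₁ᵛ   = refl
  ... | x₂ᵛ   = refl
  ... | x₃ᵛ   = refl
  ... | k₁ᵛ i = contradiction (subst (λ p → T (partEdge p p)) (sym (pt-k₁ i)) _) ¬clique
  ... | k₂ᵛ j = contradiction (subst (λ p → T (partEdge p p)) (sym (pt-k₂ j)) _) ¬clique

  same-part : ∀ u v → pt u ≡ pt v → ¬ T (partEdge (pt v) (pt v)) → u ≡ v
  same-part u v same ¬clique = begin
    u          ≡⟨ singleton u (subst (λ p → ¬ T (partEdge p p)) (sym same) ¬clique) ⟩
    rep (pt u) ≡⟨ cong rep same ⟩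
    rep (pt v) ≡⟨ sym (singleton v ¬clique) ⟩
    v          ∎
    where open ≡-Reasoning

  near⇒edge : ∀ u v → u ≢ v → Near (pt u) (pt v) → E u v
  near⇒edge u v u≢v (inj₂ e) = edge-intro u≢v e
  near⇒edge u v u≢v (inj₁ same) with T? (partEdge (pt v) (pt v))
  ... | yes clique = edge-intro u≢v (subst (λ p → T (partEdge p (pt v))) (sym same) clique)
  ... | no ¬clique = contradiction (same-part u v same ¬clique) u≢v

  dominates⇒near : ∀ c v → Dominates G c v → Near (pt c) (pt v)
  dominates⇒near c v (inj₁ refl) = inj₁ refl
  dominates⇒near c v (inj₂ e)    = inj₂ (edge-parts c v e)

  dominator-part : ∀ {D} c v → v ∉ D → c ∈ D → Dominates G c v → T (partEdge (pt v) (pt c))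
  dominator-part c v v∉D c∈D (inj₁ refl) = contradiction c∈D v∉D
  dominator-part c v v∉D c∈D (inj₂ e)    = partEdge-sym (pt c) (pt v) (edge-parts c v e)

  far-parts : ∀ c v {p q} → pt c ≡ p → pt v ≡ q → p ≢ q → ¬ T (partEdge p q) → ¬ Dominates G c v
  far-parts c v refl refl p≢q ¬e = far p≢q ¬e ∘ dominates⇒near c v

  -- Lower bound γc(𝒜) ≥ 3: every connected dominating set meets three
  -- parts.

  avoids : ∀ {D} x b → x ∉ D → b ∈ D → ¬ T (partEdge (pt x) (pt x)) → pt b ≢ pt x
  avoids {D} x b x∉D b∈D ¬clique same = x∉D (subst (_∈ D) (same-part b x same ¬clique) b∈D)

  three-parts : ∀ {D u v w} → u ∈ D → v ∈ D → w ∈ D →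
                pt u ≢ pt v → pt u ≢ pt w → pt v ≢ pt w → 3 ≤ ∣ D ∣
  three-parts u∈D v∈D w∈D uv uw vw = 3≤∣p∣ u∈D v∈D w∈D (uv ∘ cong pt) (uw ∘ cong pt) (vw ∘ cong pt)

  -- If the only part next to that of s met by D is q, then D meets
  -- three parts: a walk from s to c must pass through q.
  meets-three : ∀ {D} s c q → InducedConnected G D → s ∈ D → c ∈ D → pt c ≢ pt s → pt c ≢ q →
    (∀ {b} → b ∈ D → T (partEdge (pt s) (pt b)) → pt b ≢ pt s → pt b ≡ q) → 3 ≤ ∣ D ∣
  meets-three s c q con s∈D c∈D c∉s c≢q next
    with exit (λ v → pt v ≡ pt s) (λ v → pt v ≟ₚ pt s) (con s c s∈D c∈D) refl c∉s
  ... | a′ , b , b∈D , a′b , a′∈s , b∉s =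
    three-parts s∈D b∈D c∈D (b∉s ∘ sym) (≢-sym c∉s) (≢-resp b≡q refl (≢-sym c≢q))
    where
    b≡q : pt b ≡ q
    b≡q = next b∈D (subst (λ p → T (partEdge p (pt b))) a′∈s (edge-parts a′ b a′b)) b∉s

  -- D contains x₂ but not x₃: a dominator of k₂ 0 lies outside X2 and K1,
  -- and D can only leave x₂ towards K1.
  x₂-without-x₃ : ∀ D → IsCDS G D → x₂ ∈ D → x₃ ∉ D → 3 ≤ ∣ D ∣
  x₂-without-x₃ D (dom , con) x₂∈D x₃∉D with dominator dom (k₂ zero)
  ... | c , c∈D , c▸k₂ =
    meets-three x₂ c K1 con x₂∈D c∈D (away (far (λ ()) (λ ())) c-near) (away (far (λ ()) (λ ())) c-near) next
    where
    c-near : Near (pt c) K2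
    c-near = subst (Near (pt c)) (pt-k₂ zero) (dominates⇒near c (k₂ zero) c▸k₂)
    next : ∀ {b} → b ∈ D → T (partEdge X2 (pt b)) → pt b ≢ X2 → pt b ≡ K1
    next {b} b∈D e _ with neighbours-X2 e
    ... | inj₁ b∈K1 = b∈K1
    ... | inj₂ b∈X3 = contradiction b∈X3 (avoids x₃ b x₃∉D b∈D (λ ()))

  x₃-without-x₂ : ∀ D → IsCDS G D → x₃ ∈ D → x₂ ∉ D → 3 ≤ ∣ D ∣
  x₃-without-x₂ D (dom , con) x₃∈D x₂∉D with dominator dom (k₁ zero)
  ... | c , c∈D , c▸k₁ =
    meets-three x₃ c K2 con x₃∈D c∈D (away (far (λ ()) (λ ())) c-near) (away (far (λ ()) (λ ())) c-near) next
    where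
    c-near : Near (pt c) K1
    c-near = subst (Near (pt c)) (pt-k₁ zero) (dominates⇒near c (k₁ zero) c▸k₁)
    next : ∀ {b} → b ∈ D → T (partEdge X3 (pt b)) → pt b ≢ X3 → pt b ≡ K2
    next {b} b∈D e _ with neighbours-X3 e
    ... | inj₁ b∈K2 = b∈K2
    ... | inj₂ b∈X2 = contradiction b∈X2 (avoids x₂ b x₂∉D b∈D (λ ()))

  -- D contains neither x₂ nor x₃: their dominators lie in K1 and K2, and D
  -- can only leave K1 towards x₁.
  neither-x₂-nor-x₃ : ∀ D → IsCDS G D → x₂ ∉ D → x₃ ∉ D → 3 ≤ ∣ D ∣
  neither-x₂-nor-x₃ D (dom , con) x₂∉D x₃∉D
    with dominator dom x₂ | dominator dom x₃
  ... | w , w∈D , w▸x₂ | u , u∈D , u▸x₃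
    with neighbours-X2 (dominator-part w x₂ x₂∉D w∈D w▸x₂) | neighbours-X3 (dominator-part u x₃ x₃∉D u∈D u▸x₃)
  ... | inj₂ w∈X3 | _         = contradiction w∈X3 (avoids x₃ w x₃∉D w∈D (λ ()))
  ... | _         | inj₂ u∈X2 = contradiction u∈X2 (avoids x₂ u x₂∉D u∈D (λ ()))
  ... | inj₁ w∈K1 | inj₁ u∈K2 =
    meets-three w u X1 con w∈D u∈D (≢-resp u∈K2 w∈K1 (λ ())) (≢-resp u∈K2 refl (λ ())) next
    where
    next : ∀ {b} → b ∈ D → T (partEdge (pt w) (pt b)) → pt b ≢ pt w → pt b ≡ X1
    next {b} b∈D e b∉w
      with neighbours-K1 (subst (λ p → T (partEdge p (pt b))) w∈K1 e) (≢-resp refl (sym w∈K1) b∉w)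
    ... | inj₁ b∈X1 = b∈X1
    ... | inj₂ b∈X2 = contradiction b∈X2 (avoids x₂ b x₂∉D b∈D (λ ()))

  γc≥3 : ∀ D → IsCDS G D → 3 ≤ ∣ D ∣
  γc≥3 D cds with x₂ ∈? D | x₃ ∈? D
  ... | yes x₂∈D | no x₃∉D  = x₂-without-x₃ D cds x₂∈D x₃∉D
  ... | no x₂∉D  | yes x₃∈D = x₃-without-x₂ D cds x₃∈D x₂∉D
  ... | no x₂∉D  | no x₃∉D  = neither-x₂-nor-x₃ D cds x₂∉D x₃∉D
  ... | yes x₂∈D | yes x₃∈D with dominator (proj₁ cds) x₁
  ...   | c , c∈D , c▸x₁ =
    three-parts x₂∈D x₃∈D c∈D (λ ()) (≢-sym (away (far (λ ()) (λ ())) c-near)) (≢-sym (away (far (λ ()) (λ ())) c-near))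
    where
    c-near : Near (pt c) X1
    c-near = dominates⇒near c x₁ c▸x₁

  A : Fin t₁ → Fin t₂ → Subset N
  A i j = triple (k₁ i) x₁ (k₂ j)

  A-cds : ∀ i j → IsCDS G (A i j)
  A-cds i j = path-cds (k₁~x₁ i) (x₁~k₁ i) (x₁~k₂ j) (k₂~x₁ j) dom
    where
    dom : ∀ v → Dominates G (k₁ i) v ⊎ Dominates G x₁ v ⊎ Dominates G (k₂ j) v
    dom v with view v
    ... | x₁ᵛ    = inj₂ (inj₁ (inj₁ refl))
    ... | x₂ᵛ    = inj₁ (inj₂ (k₁~x₂ i))
    ... | x₃ᵛ    = inj₂ (inj₂ (inj₂ (k₂~x₃ j)))
    ... | k₁ᵛ i′ = inj₂ (inj₁ (inj₂ (x₁~k₁ i′)))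
    ... | k₂ᵛ j′ = inj₂ (inj₁ (inj₂ (x₁~k₂ j′)))

  B : Subset N
  B = triple (k₁ zero) x₂ x₃

  B-cds : IsCDS G B
  B-cds = path-cds (k₁~x₂ zero) (x₂~k₁ zero) x₂~x₃ x₃~x₂ dom
    where
    dom : ∀ v → Dominates G (k₁ zero) v ⊎ Dominates G x₂ v ⊎ Dominates G x₃ v
    dom v with view v
    ... | x₁ᵛ    = inj₁ (inj₂ (k₁~x₁ zero))
    ... | x₂ᵛ    = inj₂ (inj₁ (inj₁ refl))
    ... | x₃ᵛ    = inj₂ (inj₂ (inj₁ refl))
    ... | k₁ᵛ i′ = inj₂ (inj₁ (inj₂ (x₂~k₁ i′)))
    ... | k₂ᵛ j′ = inj₂ (inj₂ (inj₂ (x₃~k₂ j′)))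

  γc=3 : GammaC G 3
  γc=3 = gammaC-intro (A-cds zero zero) (∣triple∣≤3 (k₁ zero) x₁ (k₂ zero)) γc≥3

  H : Subset N
  H = tabulate (inH ∘ pt)

  x₁∈H : x₁ ∈ H
  x₁∈H = ∈-tabulate⁺ (inH ∘ pt) _

  k₁∈H : ∀ i → k₁ i ∈ H
  k₁∈H i = ∈-tabulate⁺ (inH ∘ pt) (subst (T ∘ inH) (sym (pt-k₁ i)) _)

  H-maximal-clique : IsMaximalClique G H
  H-maximal-clique = clique , maximal
    where
    clique : IsClique G H
    clique u v u∈H v∈H u≢v =
      near⇒edge u v u≢v (inH-near (pt u) (pt v) (∈-tabulate⁻ (inH ∘ pt) u∈H) (∈-tabulate⁻ (inH ∘ pt) v∈H))
    maximal : ∀ x → x ∉ H → Σ (Fin N) λ h → h ∈ H × ¬ E x h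
    maximal x x∉H with view x
    ... | x₁ᵛ   = contradiction x₁∈H x∉H
    ... | x₂ᵛ   = x₁ , x₁∈H , non-edge-by-parts x₂ x₁ refl refl (λ ())
    ... | x₃ᵛ   = x₁ , x₁∈H , non-edge-by-parts x₃ x₁ refl refl (λ ())
    ... | k₁ᵛ i = contradiction (k₁∈H i) x∉H
    ... | k₂ᵛ j = k₁ zero , k₁∈H zero , non-edge-by-parts (k₂ j) (k₁ zero) (pt-k₂ j) (pt-k₁ zero) (λ ())

  Through : Fin N → Set
  Through x = Σ (Subset N) λ D → IsGammaCSet G D × x ∈ D × Meets D H

  through-A : ∀ i j {x} → x ∈ A i j → Through x
  through-A i j x∈A = A i j , γc-set-intro (A-cds i j) (∣triple∣≤3 (k₁ i) x₁ (k₂ j)) γc≥3 , x∈A ,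
                      x₁ , ∈triple₂ (k₁ i) x₁ (k₂ j) , x₁∈H

  through-B : ∀ {x} → x ∈ B → Through x
  through-B x∈B = B , γc-set-intro B-cds (∣triple∣≤3 (k₁ zero) x₂ x₃) γc≥3 , x∈B ,
                  k₁ zero , ∈triple₁ (k₁ zero) x₂ x₃ , k₁∈H zero

  γc-set-through : ∀ x → Through x
  γc-set-through x with view x
  ... | x₁ᵛ   = through-A zero zero (∈triple₂ (k₁ zero) x₁ (k₂ zero))
  ... | x₂ᵛ   = through-B (∈triple₂ (k₁ zero) x₂ x₃)
  ... | x₃ᵛ   = through-B (∈triple₃ (k₁ zero) x₂ x₃)
  ... | k₁ᵛ i = through-A i zero (∈triple₁ (k₁ i) x₁ (k₂ zero))
  ... | k₂ᵛ j = through-A zero j (∈triple₃ (k₁ zero) x₁ (k₂ j))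

  -- Criticality: γc(𝒜 + uv) = 2 for every non-edge uv, witnessed by sets
  -- meeting H.

  Small : Fin N → Fin N → Set
  Small u v = Σ (Subset N) λ D → IsCDS (addEdge G u v) D × ∣ D ∣ ≤ 2 × Meets D H

  small-swap : ∀ u v → Small v u → Small u v
  small-swap u v (D , cds , size , meets) = D , cds-mono (λ {x} {y} → addEdge-comm {G = G} {u} {v} {x} {y}) cds , size , meets

  small-pair : ∀ u v → (∀ w → Dominates G u w ⊎ Dominates G v w) → u ∈ H ⊎ v ∈ H → Small u v
  small-pair u v dom (inj₁ u∈H) = pair u v , dominating-pair dom , ∣pair∣≤2 u v , u , ∈pair₁ u v , u∈H
  small-pair u v dom (inj₂ v∈H) = pair u v , dominating-pair dom , ∣pair∣≤2 u v , v , ∈pair₂ u v , v∈H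

  small-x₁x₂ : Small x₁ x₂
  small-x₁x₂ = small-pair x₁ x₂ dom (inj₁ x₁∈H)
    where
    dom : ∀ w → Dominates G x₁ w ⊎ Dominates G x₂ w
    dom w with view w
    ... | x₁ᵛ   = inj₁ (inj₁ refl)
    ... | x₂ᵛ   = inj₂ (inj₁ refl)
    ... | x₃ᵛ   = inj₂ (inj₂ x₂~x₃)
    ... | k₁ᵛ i = inj₁ (inj₂ (x₁~k₁ i))
    ... | k₂ᵛ j = inj₁ (inj₂ (x₁~k₂ j))

  small-x₁x₃ : Small x₁ x₃
  small-x₁x₃ = small-pair x₁ x₃ dom (inj₁ x₁∈H)
    where
    dom : ∀ w → Dominates G x₁ w ⊎ Dominates G x₃ w
    dom w with view w
    ... | x₁ᵛ   = inj₁ (inj₁ refl)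
    ... | x₂ᵛ   = inj₂ (inj₂ x₃~x₂)
    ... | x₃ᵛ   = inj₂ (inj₁ refl)
    ... | k₁ᵛ i = inj₁ (inj₂ (x₁~k₁ i))
    ... | k₂ᵛ j = inj₁ (inj₂ (x₁~k₂ j))

  small-x₃k₁ : ∀ i → Small x₃ (k₁ i)
  small-x₃k₁ i = small-pair x₃ (k₁ i) dom (inj₂ (k₁∈H i))
    where
    dom : ∀ w → Dominates G x₃ w ⊎ Dominates G (k₁ i) w
    dom w with view w
    ... | x₁ᵛ    = inj₂ (inj₂ (k₁~x₁ i))
    ... | x₂ᵛ    = inj₁ (inj₂ x₃~x₂)
    ... | x₃ᵛ    = inj₁ (inj₁ refl)
    ... | k₁ᵛ i′ = inj₂ (k₁-dominates i i′)
    ... | k₂ᵛ j  = inj₁ (inj₂ (x₃~k₂ j))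

  small-k₁k₂ : ∀ i j → Small (k₁ i) (k₂ j)
  small-k₁k₂ i j = small-pair (k₁ i) (k₂ j) dom (inj₁ (k₁∈H i))
    where
    dom : ∀ w → Dominates G (k₁ i) w ⊎ Dominates G (k₂ j) w
    dom w with view w
    ... | x₁ᵛ    = inj₁ (inj₂ (k₁~x₁ i))
    ... | x₂ᵛ    = inj₁ (inj₂ (k₁~x₂ i))
    ... | x₃ᵛ    = inj₂ (inj₂ (k₂~x₃ j))
    ... | k₁ᵛ i′ = inj₁ (k₁-dominates i i′)
    ... | k₂ᵛ j′ = inj₂ (k₂-dominates j j′)

  -- For the non-edge x₂ k₂ j the pair {x₁, k₂ j} works: the new edge lets
  -- k₂ j dominate x₂.
  small-x₂k₂ : ∀ j → Small x₂ (k₂ j)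
  small-x₂k₂ j = pair x₁ (k₂ j) , pair-cds (lift x₁ (k₂ j) (x₁~k₂ j)) (lift (k₂ j) x₁ (k₂~x₁ j)) dom , ∣pair∣≤2 x₁ (k₂ j) ,
                x₁ , ∈pair₁ x₁ (k₂ j) , x₁∈H
    where
    G′ = addEdge G x₂ (k₂ j)
    lift : ∀ x y → E x y → Edge G′ x y
    lift x y = addEdge-⊇ {G = G} {x₂} {k₂ j} {x} {y}
    dom : ∀ w → Dominates G′ x₁ w ⊎ Dominates G′ (k₂ j) w
    dom w with view w
    ... | x₁ᵛ    = inj₁ (inj₁ refl)
    ... | x₂ᵛ    = inj₂ (inj₂ (addEdge-new′ {G = G} {x₂} {k₂ j}))
    ... | x₃ᵛ    = inj₂ (inj₂ (lift (k₂ j) x₃ (k₂~x₃ j)))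
    ... | k₁ᵛ i  = inj₁ (inj₂ (lift x₁ (k₁ i) (x₁~k₁ i)))
    ... | k₂ᵛ j′ = inj₁ (inj₂ (lift x₁ (k₂ j′) (x₁~k₂ j′)))

  small : ∀ u v → NonAdj G u v → Small u v
  small u v (u≢v , ¬uv) with view u | view v
  ... | x₁ᵛ   | x₁ᵛ    = contradiction refl u≢v
  ... | x₁ᵛ   | x₂ᵛ    = small-x₁x₂
  ... | x₁ᵛ   | x₃ᵛ    = small-x₁x₃
  ... | x₁ᵛ   | k₁ᵛ i  = contradiction (x₁~k₁ i) ¬uv
  ... | x₁ᵛ   | k₂ᵛ j  = contradiction (x₁~k₂ j) ¬uv
  ... | x₂ᵛ   | x₁ᵛ    = small-swap x₂ x₁ small-x₁x₂
  ... | x₂ᵛ   | x₂ᵛ    = contradiction refl u≢v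
  ... | x₂ᵛ   | x₃ᵛ    = contradiction x₂~x₃ ¬uv
  ... | x₂ᵛ   | k₁ᵛ i  = contradiction (x₂~k₁ i) ¬uv
  ... | x₂ᵛ   | k₂ᵛ j  = small-x₂k₂ j
  ... | x₃ᵛ   | x₁ᵛ    = small-swap x₃ x₁ small-x₁x₃
  ... | x₃ᵛ   | x₂ᵛ    = contradiction x₃~x₂ ¬uv
  ... | x₃ᵛ   | x₃ᵛ    = contradiction refl u≢v
  ... | x₃ᵛ   | k₁ᵛ i  = small-x₃k₁ i
  ... | x₃ᵛ   | k₂ᵛ j  = contradiction (x₃~k₂ j) ¬uv
  ... | k₁ᵛ i | x₁ᵛ    = contradiction (k₁~x₁ i) ¬uv
  ... | k₁ᵛ i | x₂ᵛ    = contradiction (k₁~x₂ i) ¬uv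
  ... | k₁ᵛ i | x₃ᵛ    = small-swap (k₁ i) x₃ (small-x₃k₁ i)
  ... | k₁ᵛ i | k₁ᵛ i′ = contradiction (k₁~k₁ (u≢v ∘ cong k₁)) ¬uv
  ... | k₁ᵛ i | k₂ᵛ j  = small-k₁k₂ i j
  ... | k₂ᵛ j | x₁ᵛ    = contradiction (k₂~x₁ j) ¬uv
  ... | k₂ᵛ j | x₂ᵛ    = small-swap (k₂ j) x₂ (small-x₂k₂ j)
  ... | k₂ᵛ j | x₃ᵛ    = contradiction (k₂~x₃ j) ¬uv
  ... | k₂ᵛ j | k₁ᵛ i  = small-swap (k₂ j) (k₁ i) (small-k₁k₂ i j)
  ... | k₂ᵛ j | k₂ᵛ j′ = contradiction (k₂~k₂ (u≢v ∘ cong k₂)) ¬uv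

  -- No vertex dominates 𝒜 + uv: each vertex misses two vertices of 𝒜.
  two-undominated : ∀ c → Σ (Fin N) λ w₁ → Σ (Fin N) λ w₂ →
                    w₁ ≢ w₂ × ¬ Dominates G c w₁ × ¬ Dominates G c w₂
  two-undominated c with view c
  ... | x₁ᵛ   = x₂ , x₃ , (λ ()) , far-parts x₁ x₂ refl refl (λ ()) (λ ()) , far-parts x₁ x₃ refl refl (λ ()) (λ ())
  ... | x₂ᵛ   = x₁ , k₂ zero , (λ ()) , far-parts x₂ x₁ refl refl (λ ()) (λ ())
                               , far-parts x₂ (k₂ zero) refl (pt-k₂ zero) (λ ()) (λ ())
  ... | x₃ᵛ   = x₁ , k₁ zero , (λ ()) , far-parts x₃ x₁ refl refl (λ ()) (λ ())
                               , far-parts x₃ (k₁ zero) refl (pt-k₁ zero) (λ ()) (λ ())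
  ... | k₁ᵛ i = x₃ , k₂ zero , (λ ()) , far-parts (k₁ i) x₃ (pt-k₁ i) refl (λ ()) (λ ())
                               , far-parts (k₁ i) (k₂ zero) (pt-k₁ i) (pt-k₂ zero) (λ ()) (λ ())
  ... | k₂ᵛ j = x₂ , k₁ zero , (λ ()) , far-parts (k₂ j) x₂ (pt-k₂ j) refl (λ ()) (λ ())
                               , far-parts (k₂ j) (k₁ zero) (pt-k₂ j) (pt-k₁ zero) (λ ()) (λ ())

  γc+uv≥2 : ∀ u v D → IsCDS (addEdge G u v) D → 2 ≤ ∣ D ∣
  γc+uv≥2 u v D (dom , _) = 2≤dominating x₁ undominated dom
    where
    undominated : ∀ c → Σ (Fin N) λ w → ¬ Dominates (addEdge G u v) c w
    undominated c with two-undominated c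
    ... | w₁ , w₂ , w₁≢w₂ , ¬d₁ , ¬d₂ = add-one-edge {G = G} w₁≢w₂ ¬d₁ ¬d₂

  critical : Critical 3 G
  critical = γc=3 , λ u v uv → 2 , s≤s ≤-refl , γc+uv=2 u v (small u v uv)
    where
    γc+uv=2 : ∀ u v → Small u v → GammaC (addEdge G u v) 2
    γc+uv=2 u v (D , cds , size , _) = gammaC-intro cds size (γc+uv≥2 u v)

  in-𝒫 : InP 3 G
  in-𝒫 = critical , H , H-maximal-clique , 2≤∣p∣ x₁∈H (k₁∈H zero) (λ ()) , γc-set-through ,
         λ x y xy → let (D , cds , size , meets) = small x y xy in D , cds , s≤s size , meets

  claw-free : ClawFree G
  claw-free = two-cliques⇒claw-free G (λ c v → side (pt c) (pt v)) clique
    where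
    clique : ∀ c u v → E c u → E c v → u ≢ v → side (pt c) (pt u) ≡ side (pt c) (pt v) → E u v
    clique c u v cu cv u≢v same =
      near⇒edge u v u≢v (side-clique (pt c) (pt u) (pt v) (edge-parts c u cu) (edge-parts c v cv) same)

  -- Every vertex has three distinct neighbours; K₁ and K₂ have at least two
  -- vertices.
  min-degree : MinDegreeAtLeast 3 G
  min-degree v with view v
  ... | x₁ᵛ = 3≤degree {G = G} x₁ (k₁ zero) (k₁ (suc zero)) (k₂ zero)
                (x₁~k₁ zero) (x₁~k₁ (suc zero)) (x₁~k₂ zero) (λ ()) (λ ()) (λ ())
  ... | x₂ᵛ = 3≤degree {G = G} x₂ (k₁ zero) (k₁ (suc zero)) x₃
                (x₂~k₁ zero) (x₂~k₁ (suc zero)) x₂~x₃ (λ ()) (λ ()) (λ ())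
  ... | x₃ᵛ = 3≤degree {G = G} x₃ (k₂ zero) (k₂ (suc zero)) x₂
                (x₃~k₂ zero) (x₃~k₂ (suc zero)) x₃~x₂ ((λ ()) ∘ k₂-injective {zero} {suc zero}) (λ ()) (λ ())
  ... | k₁ᵛ i = let (i′ , i≢i′) = another i in
                3≤degree {G = G} (k₁ i) x₁ x₂ (k₁ i′) (k₁~x₁ i) (k₁~x₂ i) (k₁~k₁ i≢i′) (λ ()) (λ ()) (λ ())
  ... | k₂ᵛ j = let (j′ , j≢j′) = another j in
                3≤degree {G = G} (k₂ j) x₁ x₃ (k₂ j′) (k₂~x₁ j) (k₂~x₃ j) (k₂~k₂ j≢j′) (λ ()) (λ ()) (λ ())

  -- Removing S = {x₁, x₂} leaves K₁ as a set of t₁ vertices with no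
  -- neighbours outside; so 𝒜 - S has no perfect matching when t₁ is odd.
  not-2-factor-critical : ¬ (2 ∣ t₁) → ¬ FactorCritical 2 G
  not-2-factor-critical t₁-odd factor-critical =
    t₁-odd (closed-set-even G S k₁ k₁-injective (λ {u} {v} → edge-distinct u v) k₁∉S K₁-closed
                            (factor-critical S ∣S∣≡2))
    where
    S : Subset N
    S = pair x₁ x₂
    ∣S∣≡2 : ∣ S ∣ ≡ 2
    ∣S∣≡2 = ≤-antisym (∣pair∣≤2 x₁ x₂) (2≤∣p∣ (∈pair₁ x₁ x₂) (∈pair₂ x₁ x₂) (λ ()))
    k₁∉S : ∀ i → k₁ i ∉ S
    k₁∉S i k₁∈S with ∈pair⁻ {a = x₁} {b = x₂} k₁∈S
    ... | inj₁ ()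
    ... | inj₂ ()
    K₁-closed : ∀ i w → w ∉ S → E (k₁ i) w → Σ (Fin t₁) λ j → w ≡ k₁ j
    K₁-closed i w w∉S e with view w
    ... | x₁ᵛ   = contradiction (∈pair₁ x₁ x₂) w∉S
    ... | x₂ᵛ   = contradiction (∈pair₂ x₁ x₂) w∉S
    ... | x₃ᵛ   = contradiction e (non-edge-by-parts (k₁ i) x₃ (pt-k₁ i) refl (λ ()))
    ... | k₁ᵛ j = j , refl
    ... | k₂ᵛ j = contradiction e (non-edge-by-parts (k₁ i) (k₂ j) (pt-k₁ i) (pt-k₂ j) (λ ()))

  in-Q̃ : ¬ (2 ∣ t₁) → InQ 3 2 G
  in-Q̃ t₁-odd = critical , claw-free , min-degree , not-2-factor-critical t₁-odd

-- Lemma 2.1.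
lemma21 : (t₁ t₂ : ℕ) → 2 ≤ t₁ → ¬ (2 ∣ t₁) → 2 ≤ t₂ → 2 ∣ t₂ →
    InP 3 (𝒜 t₁ t₂) × InQ 3 2 (𝒜 t₁ t₂)
lemma21 (suc (suc a)) (suc (suc b)) (s≤s (s≤s _)) t₁-odd (s≤s (s≤s _)) _ = in-𝒫 , in-Q̃ t₁-odd
  where open 𝒜-Properties a b
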